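{- Let $\mathcal R$ be a real-time rewrite theory (flat object-oriented, with the object-oriented tick rule described in the context), let $L_\Pi$ be a labeling function for $\mathcal R$ with $p,q\in\Pi$, let $\{t_0\}$ be an initial state of $\mathcal R$, and let $r$ be a time value. Let $\widetilde{\mathcal R}$, $\widetilde L_\Pi$ and $\{\widetilde t_0\}$ be the result of the BR-transformation (for $p,q,r$) applied to $\mathcal R$, $L_\Pi$ and $\{t_0\}$. Then: (1) for every timed path $\{t_0\}\xrightarrow{r_0}\{t_1\}\xrightarrow{r_1}\cdots$ of $\mathcal R$ there is a timed path $\{\widetilde t_0\}\xrightarrow{r_0}\{\widetilde t_1\}\xrightarrow{r_1}\cdots$ of $\widetilde{\mathcal R}$ (with the same durations) such that for every $i$ there is a term $t_i'$ with $\widetilde t_i = t_i\ t_i'$ (multiset union of configurations); and (2) conversely, for every timed path $\{\widetilde t_0\}\xrightarrow{r_0}\{\widetilde t_1\}\xrightarrow{r_1}\cdots$ of $\widetilde{\mathcal R}$ there is a timed path $\{t_0\}\xrightarrow{r_0}\{t_1\}\xrightarrow{r_1}\cdots$ of $\mathcal R$ such that for every $i$, $\widetilde t_i = t_i\ t_i'$ for some $t_i'$.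
   Context: A real-time rewrite theory $\mathcal R=(\Sigma,E,IR,TR)$ consists of an equational theory $(\Sigma,E)$ (confluent, terminating) containing a sort Time, a set $IR$ of instantaneous rewrite rules $t\Rightarrow t'\ \text{if}\ cond$ (taking zero time), and tick rules $\{t\}\Rightarrow\{t'\}\ \text{in time}\ \tau\ \text{if}\ cond$. Here we consider flat object-oriented theories: a state has the form $\{C\}$ where $C$ is a configuration, i.e. a multiset (associative-commutative juxtaposition) of objects $\langle O : Cl \mid att_1:v_1,\dots,att_n:v_n\rangle$ and messages; the only tick rule is $\{C\}\Rightarrow\{\mathrm{delta}(C,T)\}$ in time $T$ if $T\le \mathrm{mte}(C)$, where $\mathrm{delta}$ and $\mathrm{mte}$ distribute over the objects/messages of the configuration ($\mathrm{delta}$ homomorphically, $\mathrm{mte}$ as a minimum). We write $t\xrightarrow{r}t'$ for a one-step rewrite of duration $r$ (instantaneous rules have duration $0$). A timed path is an infinite sequence $t_0\xrightarrow{r_0}t_1\xrightarrow{r_1}\cdots$ such that either every step is a one-step rewrite of $\mathcal R$, or for some $k$ steps $0,\dots,k-1$ are one-step rewrites, $t_k$ has no one-step rewrite, and $t_j=t_k$, $r_{j-1}=0$ for all $j>k$. A labeling function $L_\Pi$ assigns to each state the set of atomic propositions from $\Pi$ holding in it; "$\{t\}\models p$" means $p\in L_\Pi(\{t\})$. BR-transformation for propositions $p,q$ and time bound $r$: (i) add a class Clock with attributes clock (of sort Time) and status (of sort OnOff with constants on, off), and a fresh object identifier $c_{BR}$; (ii) the initial state becomes $\{t_0\ \langle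 c_{BR}:\mathrm{Clock}\mid \mathrm{clock}:0,\mathrm{status}:x\rangle\}$ where $x=\mathrm{on}$ if $p\in L_\Pi(\{t_0\})$ and $q\notin L_\Pi(\{t_0\})$, and $x=\mathrm{off}$ otherwise; (iii) the tick rule is kept, with $\mathrm{delta}(\langle c_{BR}\mid\mathrm{status}:\mathrm{on},\mathrm{clock}:T\rangle,T')$ setting clock to $T+T'$ if $T\le r$ and leaving it $T$ otherwise, $\mathrm{delta}$ leaving an off clock unchanged, and $\mathrm{mte}(\text{clock object})=\infty$; (iv) each instantaneous rule $t\Rightarrow t'$ if $cond$ (or $\{t\}\Rightarrow\{t'\}$ if $cond$) is replaced by four rules, with REST a fresh configuration variable: from $\{t\ \mathrm{REST}\ \langle c_{BR}\mid\mathrm{status}:\mathrm{on}\rangle\}$ to $\{t'\ \mathrm{REST}\ \langle c_{BR}\mid\rangle\}$ (clock unchanged) if $\{t'\ \mathrm{REST}\}\not\models q$ and $cond$; from the same left side to $\{t'\ \mathrm{REST}\ \langle c_{BR}\mid \mathrm{status}:\mathrm{off}\rangle\}$ if $\{t'\ \mathrm{REST}\}\models q$ and $cond$; from $\{t\ \mathrm{REST}\ \langle c_{BR}\mid\mathrm{status}:\mathrm{off}\rangle\}$ to $\{t'\ \mathrm{REST}\ \langle c_{BR}\mid\mathrm{clock}:0,\mathrm{status}:\mathrm{on}\rangle\}$ if $\{t'\ \mathrm{REST}\}\models p$, $\{t'\ \mathrm{REST}\}\not\models q$ and $cond$; and from the same left side to $\{t'\ \mathrm{REST}\ \langle c_{BR}\mid\rangle\}$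 (clock unchanged) if ($\{t'\ \mathrm{REST}\}\models q$ or $\{t'\ \mathrm{REST}\}\not\models p$) and $cond$. The labeling becomes $\widetilde L_\Pi(\{t\ o\})=L_\Pi(\{t\})$ for every state $\{t\}$ of $\mathcal R$ and clock object $o$. -}

module Defs where

open import Data.Nat using (ℕ; suc; _<_; _≤_)
open import Data.Bool using (Bool; true; false; _∧_; not; if_then_else_)
open import Data.List using (List; []; _∷_; map; foldr; _++_)
open import Data.Product using (Σ; _×_; _,_)
open import Data.Sum using (_⊎_; inj₁; inj₂)
open import Data.Unit using (⊤)
open import Relation.Nullary using (¬_; yes; no)
open import Relation.Binary using (Decidable)
open import Relation.Binary.PropositionalEquality using (_≡_)
open import Data.List.Relation.Binary.Permutation.Propositional using (_↭_)

record TimeDomain : Set₁ where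
  field
    Time : Set
    𝟘    : Time
    _+ₜ_ : Time → Time → Time
    _≤ₜ_ : Time → Time → Set
    _≤ₜ?_ : Decidable _≤ₜ_

data Time∞ (T : Set) : Set where
  fin : T → Time∞ T
  ∞   : Time∞ T

module _ (TD : TimeDomain) where
  open TimeDomain TD

  min∞ : Time∞ Time → Time∞ Time → Time∞ Time
  min∞ ∞ y = y
  min∞ (fin a) ∞ = fin a
  min∞ (fin a) (fin b) with a ≤ₜ? b
  ... | yes _ = fin a
  ... | no  _ = fin b

  _≤∞_ : Time → Time∞ Time → Set
  τ ≤∞ fin a = τ ≤ₜ a
  τ ≤∞ ∞ = ⊤

-- Elem : objects and messages (in E-canonical form); a configuration is a
-- multiset of Elem, represented by a list, considered up to permutation _↭_.
-- Each instantaneous rule ρ is given by the relation  rule ρ C C'  saying that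
-- {C} ⇒ {C'} is a one-step application of ρ (matching, context, condition).
-- The tick rule {C} ⇒ {delta(C,T)} in time T if T ≤ mte(C) is fixed, with
-- delta/mte given per element (δ, mte) and distributed over configurations.

record FlatRTTheory (TD : TimeDomain) : Set₁ where
  open TimeDomain TD
  field
    Elem  : Set
    IRule : Set
    rule  : IRule → List Elem → List Elem → Set
    δ     : Elem → Time → Elem
    mte   : Elem → Time∞ Time

module _ {TD : TimeDomain} (R : FlatRTTheory TD) where
  open TimeDomain TD
  open FlatRTTheory R

  Config : Set
  Config = List Elem

  deltaC : Config → Time → Config
  deltaC C τ = map (λ e → δ e τ) C

  mteC : Config → Time∞ Time
  mteC C = foldr (λ e m → min∞ TD (mte e) m) ∞ C

  InstStep : Config → Config → Set
  InstStep C C' = Σ IRule λ ρ → Σ Config λ D → Σ Config λ D' →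
                    (C ↭ D) × rule ρ D D' × (D' ↭ C')

  TickStep : Config → Time → Config → Set
  TickStep C τ C' = Σ Config λ D → (C ↭ D) × _≤∞_ TD τ (mteC D) × (deltaC D τ ↭ C')

  Step : Config → Time → Config → Set
  Step C τ C' = (InstStep C C' × τ ≡ 𝟘) ⊎ TickStep C τ C'

  TimedPath : (ℕ → Config) → (ℕ → Time) → Set
  TimedPath s d =
      (∀ i → Step (s i) (d i) (s (suc i)))
    ⊎ Σ ℕ λ k → (∀ i → i < k → Step (s i) (d i) (s (suc i)))
              × (∀ τ C' → ¬ Step (s k) τ C')
              × (∀ j → k < j → s j ↭ s k)
              × (∀ j → k ≤ j → d j ≡ 𝟘)

data OnOff : Set where
  on off : OnOff

-- the (unique, fresh-identifier) clock object ⟨ c_BR : Clock | clock , status ⟩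
record Clock (T : Set) : Set where
  constructor clk
  field
    clock  : T
    status : OnOff

data BRCase : Set where
  onNotQ onQ offPNotQ offQorNotP : BRCase

module _ {TD : TimeDomain} (R : FlatRTTheory TD) (Π : Set)
         (L : List (FlatRTTheory.Elem R) → Π → Bool)   -- labeling: p ∈ L_Π({C}) iff L C p ≡ true
         (p q : Π) (r : TimeDomain.Time TD) where
  open TimeDomain TD
  open FlatRTTheory R

  BRElem : Set
  BRElem = Elem ⊎ Clock Time

  brRule : BRCase → IRule → List BRElem → List BRElem → Set
  brRule onNotQ ρ X Y = Σ (List Elem) λ C → Σ (List Elem) λ C' → Σ Time λ T →
    rule ρ C C' × L C' q ≡ false
    × X ≡ map inj₁ C ++ inj₂ (clk T on) ∷ []
    × Y ≡ map inj₁ C' ++ inj₂ (clk T on) ∷ []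
  brRule onQ ρ X Y = Σ (List Elem) λ C → Σ (List Elem) λ C' → Σ Time λ T →
    rule ρ C C' × L C' q ≡ true
    × X ≡ map inj₁ C ++ inj₂ (clk T on) ∷ []
    × Y ≡ map inj₁ C' ++ inj₂ (clk T off) ∷ []
  brRule offPNotQ ρ X Y = Σ (List Elem) λ C → Σ (List Elem) λ C' → Σ Time λ T →
    rule ρ C C' × L C' p ≡ true × L C' q ≡ false
    × X ≡ map inj₁ C ++ inj₂ (clk T off) ∷ []
    × Y ≡ map inj₁ C' ++ inj₂ (clk 𝟘 on) ∷ []
  brRule offQorNotP ρ X Y = Σ (List Elem) λ C → Σ (List Elem) λ C' → Σ Time λ T →
    rule ρ C C' × (L C' q ≡ true ⊎ L C' p ≡ false)
    × X ≡ map inj₁ C ++ inj₂ (clk T off) ∷ []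
    × Y ≡ map inj₁ C' ++ inj₂ (clk T off) ∷ []

  deltaClock : Clock Time → Time → Clock Time
  deltaClock (clk T on) τ with T ≤ₜ? r
  ... | yes _ = clk (T +ₜ τ) on
  ... | no  _ = clk T on
  deltaClock (clk T off) τ = clk T off

  brδ : BRElem → Time → BRElem
  brδ (inj₁ e) τ = inj₁ (δ e τ)
  brδ (inj₂ c) τ = inj₂ (deltaClock c τ)

  brMte : BRElem → Time∞ Time
  brMte (inj₁ e) = mte e
  brMte (inj₂ c) = ∞

  BR : FlatRTTheory TD
  BR = record
    { Elem  = BRElem
    ; IRule = BRCase × IRule
    ; rule  = λ { (c , ρ) → brRule c ρ }
    ; δ     = brδ
    ; mte   = brMte
    }

  brInit : List Elem → List BRElem
  brInit t₀ = map inj₁ t₀ ++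
    inj₂ (clk 𝟘 (if L t₀ p ∧ not (L t₀ q) then on else off)) ∷ []

  brLabel : List Elem → Clock Time → Π → Bool
  brLabel t o = L t

module Submission where

-- A state of R̃ is a multiset over Elem ⊎ Clock; its R-part is `lefts` and its
-- clock part is `rights`.  Both are invariant under permutation, so the whole
-- argument is carried out on these projections.
--   * Projection: every one-step rewrite of R̃ projects to a one-step rewrite of
--     R with the same duration (each transformed rule is an instance of the
--     original rule; the clock has mte ∞ and is ignored by delta on the R-part).
--   * Lifting: every one-step rewrite of R from {C}, for any attached clock c,
--     lifts to a rewrite of R̃ from {C c}, because the four transformed rules
--     cover every combination of clock status and truth values of p and q.
--   * Invariant: states reachable in R̃ contain exactly one clock; this is
--     what lets a deadlock of R̃ project to a deadlock of R.
-- Direction (1) lifts a path of R by threading the clock along it; direction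
-- (2) projects a path of R̃ with `lefts`.

open import Defs
open import Data.Nat using (ℕ; zero; suc; _<_; _≤_; _<?_; z≤n; s≤s)
open import Data.Nat.Properties using (<⇒≤; ≤-refl; ≤⇒≯; m≤n⇒m<n∨m≡n)
open import Data.Bool using (Bool; true; false; _∧_; not; if_then_else_)
open import Data.List using (List; []; _∷_; map; _++_; mapMaybe)
open import Data.List.Properties using (mapMaybe-++; mapMaybeIsInj₁∘mapInj₁; mapMaybeIsInj₂∘mapInj₁; ++-identityʳ)
open import Data.Maybe using (Maybe; just; nothing)
open import Data.Product using (Σ; _×_; _,_; proj₁; proj₂)
open import Data.Sum using (_⊎_; inj₁; inj₂; isInj₁; isInj₂)
open import Data.Empty using (⊥-elim)
open import Relation.Nullary using (¬_; yes; no)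
open import Relation.Binary.PropositionalEquality using (_≡_; refl; cong; sym; trans; subst)
open import Data.List.Relation.Binary.Permutation.Propositional using (_↭_; prep; ↭-refl; ↭-sym; ↭-trans)
open import Data.List.Relation.Binary.Permutation.Propositional.Properties
  using (++⁺ˡ; ++⁺ʳ; map⁺; shift; mapMaybe-↭)

module SumMultisets {A B : Set} where

  lefts : List (A ⊎ B) → List A
  lefts = mapMaybe isInj₁

  rights : List (A ⊎ B) → List B
  rights = mapMaybe isInj₂

  lefts-↭ : {X Y : List (A ⊎ B)} → X ↭ Y → lefts X ↭ lefts Y
  lefts-↭ = mapMaybe-↭ isInj₁

  rights-↭ : {X Y : List (A ⊎ B)} → X ↭ Y → rights X ↭ rights Y
  rights-↭ = mapMaybe-↭ isInj₂

  ↭-lefts++rights : (X : List (A ⊎ B)) → X ↭ map inj₁ (lefts X) ++ map inj₂ (rights X)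
  ↭-lefts++rights [] = ↭-refl
  ↭-lefts++rights (inj₁ a ∷ X) = prep (inj₁ a) (↭-lefts++rights X)
  ↭-lefts++rights (inj₂ b ∷ X) =
    ↭-trans (prep (inj₂ b) (↭-lefts++rights X)) (↭-sym (shift (inj₂ b) (map inj₁ (lefts X)) _))

  attach : List A → B → List (A ⊎ B)
  attach C b = map inj₁ C ++ inj₂ b ∷ []

  attach-↭ : {C C' : List A} (b : B) → C ↭ C' → attach C b ↭ attach C' b
  attach-↭ b C↭C' = ++⁺ʳ (inj₂ b ∷ []) (map⁺ inj₁ C↭C')

  lefts-attach : (C : List A) (b : B) → lefts (attach C b) ≡ C
  lefts-attach C b = trans (mapMaybe-++ isInj₁ (map inj₁ C) (inj₂ b ∷ []))
                           (trans (++-identityʳ _) (mapMaybeIsInj₁∘mapInj₁ C))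

  rights-attach : (C : List A) (b : B) → rights (attach C b) ≡ b ∷ []
  rights-attach C b = trans (mapMaybe-++ isInj₂ (map inj₁ C) (inj₂ b ∷ []))
                            (cong (_++ b ∷ []) (mapMaybeIsInj₂∘mapInj₁ C))

  ↭-attach : {X : List (A ⊎ B)} {b : B} → rights X ↭ b ∷ [] → X ↭ attach (lefts X) b
  ↭-attach {X} one = ↭-trans (↭-lefts++rights X) (++⁺ˡ (map inj₁ (lefts X)) (map⁺ inj₂ one))

open SumMultisets

module _ {TD : TimeDomain} (T : FlatRTTheory TD) where
  open TimeDomain TD

  Terminal : Config T → Set
  Terminal C = ∀ τ C' → ¬ Step T C τ C'

  Step-↭ˡ : ∀ {C D τ E} → C ↭ D → Step T D τ E → Step T C τ E
  Step-↭ˡ C↭D (inj₁ ((ρ , D₀ , E₀ , D↭ , rl , ↭E) , τ≡0)) = inj₁ ((ρ , D₀ , E₀ , ↭-trans C↭D D↭ , rl , ↭E) , τ≡0)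
  Step-↭ˡ C↭D (inj₂ (D₀ , D↭ , τ≤mte , δ↭E)) = inj₂ (D₀ , ↭-trans C↭D D↭ , τ≤mte , δ↭E)

  invariant-prefix : (P : Config T → Set) → (∀ {C τ C'} → Step T C τ C' → P C → P C') →
    (s : ℕ → Config T) (d : ℕ → Time) (k : ℕ) →
    (∀ i → i < k → Step T (s i) (d i) (s (suc i))) → P (s 0) → ∀ i → i ≤ k → P (s i)
  invariant-prefix P pres s d k steps P₀ zero _ = P₀
  invariant-prefix P pres s d k steps P₀ (suc i) i<k =
    pres (steps i i<k) (invariant-prefix P pres s d k steps P₀ i (<⇒≤ i<k))

module BRTransformation {TD : TimeDomain} (R : FlatRTTheory TD) (Π : Set)
  (L : List (FlatRTTheory.Elem R) → Π → Bool) (p q : Π) (r : TimeDomain.Time TD) where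
  open TimeDomain TD
  open FlatRTTheory R

  R̃ : FlatRTTheory TD
  R̃ = BR R Π L p q r

  Clk : Set
  Clk = Clock Time

  BRConfig : Set
  BRConfig = Config R̃

  tickClock : Clk → Time → Clk
  tickClock = deltaClock R Π L p q r

  -- the clock of the transformed initial state: brInit t₀ ≡ attach t₀ (initClock t₀)
  initClock : Config R → Clk
  initClock t₀ = clk 𝟘 (if L t₀ p ∧ not (L t₀ q) then on else off)

  -- the clock object has mte ∞, so it does not constrain the tick rule
  mteC-lefts : (X : BRConfig) → mteC R̃ X ≡ mteC R (lefts X)
  mteC-lefts [] = refl
  mteC-lefts (inj₁ e ∷ X) = cong (min∞ TD (mte e)) (mteC-lefts X)
  mteC-lefts (inj₂ c ∷ X) = mteC-lefts X

  mteC-attach : (C : Config R) (c : Clk) → mteC R̃ (attach C c) ≡ mteC R C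
  mteC-attach C c = trans (mteC-lefts (attach C c)) (cong (mteC R) (lefts-attach C c))

  deltaC-lefts : (X : BRConfig) (τ : Time) → lefts (deltaC R̃ X τ) ≡ deltaC R (lefts X) τ
  deltaC-lefts [] τ = refl
  deltaC-lefts (inj₁ e ∷ X) τ = cong (δ e τ ∷_) (deltaC-lefts X τ)
  deltaC-lefts (inj₂ c ∷ X) τ = deltaC-lefts X τ

  deltaC-rights : (X : BRConfig) (τ : Time) → rights (deltaC R̃ X τ) ≡ map (λ c → tickClock c τ) (rights X)
  deltaC-rights [] τ = refl
  deltaC-rights (inj₁ e ∷ X) τ = deltaC-rights X τ
  deltaC-rights (inj₂ c ∷ X) τ = cong (tickClock c τ ∷_) (deltaC-rights X τ)

  deltaC-attach : (C : Config R) (c : Clk) (τ : Time) →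
    deltaC R̃ (attach C c) τ ≡ attach (deltaC R C τ) (tickClock c τ)
  deltaC-attach [] c τ = refl
  deltaC-attach (e ∷ C) c τ = cong (inj₁ (δ e τ) ∷_) (deltaC-attach C c τ)

  brRule-instance : ∀ k ρ {X Y} → brRule R Π L p q r k ρ X Y →
    Σ (Config R) λ C → Σ (Config R) λ C' → Σ Clk λ c → Σ Clk λ c' →
      rule ρ C C' × X ≡ attach C c × Y ≡ attach C' c'
  brRule-instance onNotQ ρ (C , C' , T , rl , _ , X≡ , Y≡) = C , C' , _ , _ , rl , X≡ , Y≡
  brRule-instance onQ ρ (C , C' , T , rl , _ , X≡ , Y≡) = C , C' , _ , _ , rl , X≡ , Y≡
  brRule-instance offPNotQ ρ (C , C' , T , rl , _ , _ , X≡ , Y≡) = C , C' , _ , _ , rl , X≡ , Y≡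
  brRule-instance offQorNotP ρ (C , C' , T , rl , _ , X≡ , Y≡) = C , C' , _ , _ , rl , X≡ , Y≡

  brRules-cover : ∀ {ρ C C'} → rule ρ C C' → (c : Clk) →
    Σ BRCase λ k → Σ Clk λ c' → brRule R Π L p q r k ρ (attach C c) (attach C' c')
  brRules-cover {ρ} {C} {C'} rl (clk T on) with L C' q in q?
  ... | true  = onQ , clk T off , (C , C' , T , rl , q? , refl , refl)
  ... | false = onNotQ , clk T on , (C , C' , T , rl , q? , refl , refl)
  brRules-cover {ρ} {C} {C'} rl (clk T off) with L C' p in p? | L C' q in q?
  ... | true  | false = offPNotQ , clk 𝟘 on , (C , C' , T , rl , p? , q? , refl , refl)
  ... | true  | true  = offQorNotP , clk T off , (C , C' , T , rl , inj₁ q? , refl , refl)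
  ... | false | _     = offQorNotP , clk T off , (C , C' , T , rl , inj₂ p? , refl , refl)

  step-project : ∀ {X τ Y} → Step R̃ X τ Y → Step R (lefts X) τ (lefts Y)
  step-project {X} {τ} {Y} (inj₁ (((k , ρ) , X₀ , Y₀ , X↭ , rl̃ , ↭Y) , τ≡0)) with brRule-instance k ρ rl̃
  ... | C , C' , c , c' , rl , refl , refl =
    inj₁ ((ρ , C , C' , subst (lefts X ↭_) (lefts-attach C c) (lefts-↭ X↭) , rl ,
           subst (_↭ lefts Y) (lefts-attach C' c') (lefts-↭ ↭Y)) , τ≡0)
  step-project {X} {τ} {Y} (inj₂ (X₀ , X↭ , τ≤mte , δ↭Y)) =
    inj₂ (lefts X₀ , lefts-↭ X↭ , subst (_≤∞_ TD τ) (mteC-lefts X₀) τ≤mte ,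
          subst (_↭ lefts Y) (deltaC-lefts X₀ τ) (lefts-↭ δ↭Y))

  step-lift : ∀ {C τ C'} → Step R C τ C' → (c : Clk) → Σ Clk λ c' → Step R̃ (attach C c) τ (attach C' c')
  step-lift (inj₁ ((ρ , D , D' , C↭D , rl , D'↭C') , τ≡0)) c with brRules-cover rl c
  ... | k , c' , rl̃ =
    c' , inj₁ (((k , ρ) , attach D c , attach D' c' , attach-↭ c C↭D , rl̃ , attach-↭ c' D'↭C') , τ≡0)
  step-lift {τ = τ} {C'} (inj₂ (D , C↭D , τ≤mte , δD↭C')) c =
    tickClock c τ , inj₂ (attach D c , attach-↭ c C↭D ,
      subst (_≤∞_ TD τ) (sym (mteC-attach D c)) τ≤mte ,
      subst (_↭ attach C' (tickClock c τ)) (sym (deltaC-attach D c τ)) (attach-↭ _ δD↭C'))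

  OneClock : BRConfig → Set
  OneClock X = Σ Clk λ c → rights X ↭ c ∷ []

  OneClock-step : ∀ {X τ Y} → Step R̃ X τ Y → OneClock X → OneClock Y
  OneClock-step {Y = Y} (inj₁ (((k , ρ) , X₀ , Y₀ , X↭ , rl̃ , ↭Y) , τ≡0)) _ with brRule-instance k ρ rl̃
  ... | C , C' , c , c' , rl , refl , refl =
    c' , subst (rights Y ↭_) (rights-attach C' c') (rights-↭ (↭-sym ↭Y))
  OneClock-step {X} {τ} {Y} (inj₂ (X₀ , X↭ , τ≤mte , δ↭Y)) (c , one) =
    tickClock c τ ,
    ↭-trans (subst (rights Y ↭_) (deltaC-rights X₀ τ) (rights-↭ (↭-sym δ↭Y)))
            (map⁺ (λ c → tickClock c τ) (↭-trans (rights-↭ (↭-sym X↭)) one))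

  terminal-lift : ∀ {C} (c : Clk) → Terminal R C → Terminal R̃ (attach C c)
  terminal-lift {C} c dead τ Y st =
    dead τ (lefts Y) (subst (λ Z → Step R Z τ (lefts Y)) (lefts-attach C c) (step-project st))

  terminal-project : ∀ {X} → OneClock X → Terminal R̃ X → Terminal R (lefts X)
  terminal-project (c , one) dead τ C' st with step-lift st c
  ... | c' , st̃ = dead τ (attach C' c') (Step-↭ˡ R̃ (↭-attach one) st̃)

  -- Threading a clock along a sequence of R-states: at index i the schedule
  -- either supplies the step s i → s (i+1) (which moves the clock) or is idle.
  module ClockThread (s : ℕ → Config R) (d : ℕ → Time) (c₀ : Clk)
    (schedule : ∀ i → Maybe (Step R (s i) (d i) (s (suc i)))) where

    nextClock : ∀ {C τ C'} → Maybe (Step R C τ C') → Clk → Clk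
    nextClock nothing c = c
    nextClock (just st) c = proj₁ (step-lift st c)

    clockAt : ℕ → Clk
    clockAt zero = c₀
    clockAt (suc i) = nextClock (schedule i) (clockAt i)

    lifted : ℕ → BRConfig
    lifted i = attach (s i) (clockAt i)

    lifted-step : ∀ i st → schedule i ≡ just st → Step R̃ (lifted i) (d i) (lifted (suc i))
    lifted-step i st sched≡ =
      subst (λ m → Step R̃ (lifted i) (d i) (attach (s (suc i)) (nextClock m (clockAt i))))
            (sym sched≡) (proj₂ (step-lift st (clockAt i)))

    clock-frozen : ∀ k → (∀ m → k ≤ m → schedule m ≡ nothing) → ∀ j → k ≤ j → clockAt j ≡ clockAt k
    clock-frozen k idle zero z≤n = refl
    clock-frozen k idle (suc j) k≤1+j with m≤n⇒m<n∨m≡n k≤1+j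
    ... | inj₂ refl = refl
    ... | inj₁ (s≤s k≤j) =
      trans (cong (λ m → nextClock m (clockAt j)) (idle j k≤j)) (clock-frozen k idle j k≤j)

  prefixSchedule : (s : ℕ → Config R) (d : ℕ → Time) (k : ℕ) →
    (∀ i → i < k → Step R (s i) (d i) (s (suc i))) → ∀ i → Maybe (Step R (s i) (d i) (s (suc i)))
  prefixSchedule s d k steps i with i <? k
  ... | yes i<k = just (steps i i<k)
  ... | no  _   = nothing

  prefixSchedule-active : ∀ s d k steps i → i < k → Σ (Step R (s i) (d i) (s (suc i))) λ st →
    prefixSchedule s d k steps i ≡ just st
  prefixSchedule-active s d k steps i i<k with i <? k
  ... | yes _  = _ , refl
  ... | no i≮k = ⊥-elim (i≮k i<k)

  prefixSchedule-idle : ∀ s d k steps m → k ≤ m → prefixSchedule s d k steps m ≡ nothing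
  prefixSchedule-idle s d k steps m k≤m with m <? k
  ... | yes m<k = ⊥-elim (≤⇒≯ k≤m m<k)
  ... | no  _   = refl

  path-lift : (t₀ : Config R) (s : ℕ → Config R) (d : ℕ → Time) →
    TimedPath R s d → s 0 ↭ t₀ →
    Σ (ℕ → BRConfig) λ s̃ → TimedPath R̃ s̃ d × s̃ 0 ↭ brInit R Π L p q r t₀
      × (∀ i → Σ BRConfig λ t' → s̃ i ↭ map inj₁ (s i) ++ t')
  path-lift t₀ s d (inj₁ steps) s₀ =
    lifted , inj₁ (λ i → lifted-step i (steps i) refl) ,
    attach-↭ (initClock t₀) s₀ , λ i → inj₂ (clockAt i) ∷ [] , ↭-refl
    where open ClockThread s d (initClock t₀) (λ i → just (steps i))
  path-lift t₀ s d (inj₂ (k , steps , dead , stays , d≡0)) s₀ =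
    lifted ,
    inj₂ (k , (λ i i<k → let (st , sched≡) = prefixSchedule-active s d k steps i i<k in lifted-step i st sched≡) ,
          terminal-lift (clockAt k) dead , lifted-stays , d≡0) ,
    attach-↭ (initClock t₀) s₀ , λ i → inj₂ (clockAt i) ∷ [] , ↭-refl
    where
    open ClockThread s d (initClock t₀) (prefixSchedule s d k steps)
    lifted-stays : ∀ j → k < j → lifted j ↭ lifted k
    lifted-stays j k<j =
      subst (λ c → attach (s j) c ↭ lifted k)
            (sym (clock-frozen k (prefixSchedule-idle s d k steps) j (<⇒≤ k<j)))
            (attach-↭ (clockAt k) (stays j k<j))

  path-project : (t₀ : Config R) (s̃ : ℕ → BRConfig) (d : ℕ → Time) →
    TimedPath R̃ s̃ d → s̃ 0 ↭ brInit R Π L p q r t₀ →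
    Σ (ℕ → Config R) λ s → TimedPath R s d × s 0 ↭ t₀
      × (∀ i → Σ BRConfig λ t' → s̃ i ↭ map inj₁ (s i) ++ t')
  path-project t₀ s̃ d path s̃₀ = (λ i → lefts (s̃ i)) , projected path ,
    subst (lefts (s̃ 0) ↭_) (lefts-attach t₀ (initClock t₀)) (lefts-↭ s̃₀) ,
    λ i → map inj₂ (rights (s̃ i)) , ↭-lefts++rights (s̃ i)
    where
    oneClock₀ : OneClock (s̃ 0)
    oneClock₀ = initClock t₀ , subst (rights (s̃ 0) ↭_) (rights-attach t₀ (initClock t₀)) (rights-↭ s̃₀)

    projected : TimedPath R̃ s̃ d → TimedPath R (λ i → lefts (s̃ i)) d
    projected (inj₁ steps) = inj₁ (λ i → step-project (steps i))
    projected (inj₂ (k , steps , dead , stays , d≡0)) =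
      inj₂ (k , (λ i i<k → step-project (steps i i<k)) ,
            terminal-project (invariant-prefix R̃ OneClock OneClock-step s̃ d k steps oneClock₀ k ≤-refl) dead ,
            (λ j k<j → lefts-↭ (stays j k<j)) , d≡0)

lemma1 : (TD : TimeDomain) (R : FlatRTTheory TD) (Π : Set)
    (L : List (FlatRTTheory.Elem R) → Π → Bool) (p q : Π)
    (t₀ : List (FlatRTTheory.Elem R)) (r : TimeDomain.Time TD) →
    ((s : ℕ → List (FlatRTTheory.Elem R)) (d : ℕ → TimeDomain.Time TD) →
    TimedPath R s d → s 0 ↭ t₀ →
    Σ (ℕ → List (BRElem R Π L p q r)) λ s̃ →
    TimedPath (BR R Π L p q r) s̃ d
    × s̃ 0 ↭ brInit R Π L p q r t₀
    × (∀ i → Σ (List (BRElem R Π L p q r)) λ t' → s̃ i ↭ map inj₁ (s i) ++ t'))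
    × ((s̃ : ℕ → List (BRElem R Π L p q r)) (d : ℕ → TimeDomain.Time TD) →
    TimedPath (BR R Π L p q r) s̃ d → s̃ 0 ↭ brInit R Π L p q r t₀ →
    Σ (ℕ → List (FlatRTTheory.Elem R)) λ s →
    TimedPath R s d
    × s 0 ↭ t₀
    × (∀ i → Σ (List (BRElem R Π L p q r)) λ t' → s̃ i ↭ map inj₁ (s i) ++ t'))
lemma1 TD R Π L p q t₀ r = path-lift t₀ , path-project t₀
  where open BRTransformation R Π L p q r
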